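{- For all positive integers $k$ and $\Delta$, there exists a multihypergraph $H$ on $k$ vertices with maximum degree at most $\Delta$ such that $\chi'(H)\geq\nu(k)\Delta-k$.
   Context: A multihypergraph has a vertex set and a multiset of edges, each a set of vertices. The degree of a vertex is the number of edges containing it; $\chi'(H)$ is the least number of colours in an edge-colouring in which intersecting edges receive distinct colours. A hypergraph is intersecting if every two edges share a vertex. A fractional matching of a hypergraph $H$ is $w\colon E(H)\to[0,1]$ with $\sum_{e\ni v}w(e)\leq1$ for every vertex $v$; its size is $\sum_e w(e)$, and $\nu^*(H)$ is the maximum size of a fractional matching. $\nu(k)$ is the maximum of $\nu^*(H)$ over all intersecting hypergraphs $H$ on $k$ vertices.
   Formalization: The fractional matchings w defining ν(k) take only rational values in [0,1] rather than arbitrary real values. -}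

module Defs where

open import Data.Nat using (ℕ; zero; suc) renaming (_+_ to _+ℕ_; _≤_ to _≤ℕ_)
open import Data.Integer using (+_)
open import Data.Bool using (Bool; true; false; if_then_else_)
open import Data.Fin using (Fin; zero; suc)
open import Data.Fin.Subset using (Subset; _∈_; _∩_; Nonempty)
open import Data.Fin.Subset.Properties using (_∈?_)
open import Data.Product using (Σ; _×_; ∃)
open import Relation.Nullary using (¬_; does)
open import Relation.Binary.PropositionalEquality using (_≡_)
open import Data.Rational using (ℚ; 0ℚ; 1ℚ; _/_; _+_; _*_; _-_; _≤_)

sumℕ : (m : ℕ) → (Fin m → ℕ) → ℕ
sumℕ zero    f = 0
sumℕ (suc m) f = f zero +ℕ sumℕ m (λ i → f (suc i))

sumℚ : (m : ℕ) → (Fin m → ℚ) → ℚ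
sumℚ zero    f = 0ℚ
sumℚ (suc m) f = f zero + sumℚ m (λ i → f (suc i))

toℚ : ℕ → ℚ
toℚ n = + n / 1

-- A multihypergraph on vertex set Fin k: a family of edges indexed by Fin m
-- (so repeated edges are allowed); edges are nonempty subsets of the vertices.
record Hypergraph (k : ℕ) : Set where
  field
    m        : ℕ
    edge     : Fin m → Subset k
    nonempty : ∀ i → Nonempty (edge i)
open Hypergraph public

degree : ∀ {k} → Hypergraph k → Fin k → ℕ
degree H v = sumℕ (m H) (λ i → if does (v ∈? edge H i) then 1 else 0)

MaxDegreeAtMost : ∀ {k} → Hypergraph k → ℕ → Set
MaxDegreeAtMost H Δ = ∀ v → degree H v ≤ℕ Δ

Meet : ∀ {k} → Subset k → Subset k → Set
Meet e f = Nonempty (e ∩ f)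

Intersecting : ∀ {k} → Hypergraph k → Set
Intersecting H = ∀ i j → ¬ i ≡ j → Meet (edge H i) (edge H j)

ProperEdgeColouring : ∀ {k} → (H : Hypergraph k) → (c : ℕ) → (Fin (m H) → Fin c) → Set
ProperEdgeColouring H c col =
  ∀ i j → ¬ i ≡ j → Meet (edge H i) (edge H j) → ¬ col i ≡ col j

ChromaticIndexAtLeast : ∀ {k} → (H : Hypergraph k) → ℚ → Set
ChromaticIndexAtLeast H x =
  ∀ c (col : Fin (m H) → Fin c) → ProperEdgeColouring H c col → x ≤ toℚ c

record FractionalMatching {k} (H : Hypergraph k) : Set where
  field
    w       : Fin (m H) → ℚ
    w≥0     : ∀ i → 0ℚ ≤ w i
    w≤1     : ∀ i → w i ≤ 1ℚ
    vertex≤1 : ∀ v → sumℚ (m H) (λ i → if does (v ∈? edge H i) then w i else 0ℚ) ≤ 1ℚ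
open FractionalMatching public

size : ∀ {k} {H : Hypergraph k} → FractionalMatching H → ℚ
size {H = H} f = sumℚ (m H) (w f)

-- "χ'(H) ≥ ν(k)Δ − k" is expressed as: for every intersecting G on k vertices
-- and every fractional matching w of G, χ'(H) ≥ size(w)·Δ − k.
ChromaticIndexAtLeastνΔ-k : ∀ {k} → Hypergraph k → (Δ : ℕ) → Set
ChromaticIndexAtLeastνΔ-k {k} H Δ =
  ∀ (G : Hypergraph k) → Intersecting G → (f : FractionalMatching G) →
  ChromaticIndexAtLeast H (size f * toℚ Δ - toℚ k)

module Submission where

-- Let H be an intersecting multihypergraph on the k vertices with maximum degree at most Δ and as
-- many edges as possible; it exists because double counting bounds its number of edges by kΔ. Any
-- two edges of H meet, so every proper colouring of H is injective and χ'(H) ≥ |E(H)|.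
--
-- Now let w be a fractional matching of an intersecting G. The vector Δw puts load at most Δ on
-- every vertex, and we round it to an integer vector y with no larger load anywhere and total at
-- least Δ|w| − k: keep the integer parts, and round the fractional parts in [0,1] as follows.
-- While more than k of them remain, their incidence vectors in ℚᵏ are linearly dependent; moving
-- along a dependency, oriented so that the total does not drop, until some coordinate reaches 0
-- or 1 changes no load, and that coordinate can then be fixed. Once at most k coordinates remain,
-- setting them to 0 loses at most k. Taking y i copies of the i-th edge of G gives an
-- intersecting multihypergraph with maximum degree at most Δ, so |E(H)| ≥ Σ y ≥ Δ|w| − k.

open import Algebra.Bundles using (CommutativeRing)
import Algebra.Properties.CommutativeMonoid.Sum as MonoidSum
import Algebra.Properties.Semiring.Sum as SemiringSum
import Data.Bool.Base as Bool
open import Data.Bool.Base using (if_then_else_)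
open import Data.Empty using (⊥-elim)
open import Data.Fin.Base using (Fin; zero; suc; punchIn)
open import Data.Fin.Properties using (any?; all?; injective⇒≤) renaming (_≟_ to _≟ᶠ_)
open import Data.Fin.Subset using (Subset; _∈_; _∩_; Nonempty)
open import Data.Fin.Subset.Properties using (_∈?_; nonempty?; anySubset?; x∈p∩q⁻; x∈p∩q⁺)
open import Data.Integer.Base as ℤ using (+≤+)
import Data.Integer.Properties as ℤ
open import Data.Nat.Base as ℕ using (ℕ; zero; suc; z≤n; s≤s)
import Data.Nat.Properties as ℕ
open import Data.Nat.Coprimality using (1-coprimeTo) renaming (sym to coprime-sym)
open import Data.Product using (Σ; ∃; _×_; _,_; proj₁; proj₂)
open import Data.Rational
open import Data.Rational.Properties
open import Data.Rational.Solver using (module +-*-Solver)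
open import Data.Sum using (_⊎_; inj₁; inj₂)
open import Data.Vec.Base using (Vec; []; _∷_; _++_; lookup; replicate)
open import Data.Vec.Functional using (removeAt; insertAt)
open import Data.Vec.Functional.Properties using (insertAt-lookup; insertAt-punchIn)
open import Data.Vec.Relation.Unary.All using (All; []; _∷_)
open import Data.Vec.Relation.Unary.All.Properties using (++⁺; lookup⁺)
open import Function using (_∘_; flip)
open import Relation.Binary.Bundles using (TotalPreorder)
open import Relation.Binary.Definitions using (tri<; tri≈; tri>)
open import Relation.Binary.PropositionalEquality
open import Relation.Nullary using (Dec; yes; no; does)
open import Relation.Nullary.Decidable using (¬?; decidable-stable; map′; dec-true)
open import Relation.Unary using (Decidable)

open import Defs

open +-*-Solver

module ℕ∑ = MonoidSum ℕ.+-0-commutativeMonoid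
open SemiringSum (CommutativeRing.semiring +-*-commutativeRing)
  using (sum; sum-cong-≗; ∑-distrib-+; *-distribˡ-sum; *-distribʳ-sum; sum-remove; sum-replicate-zero)

-- Finite sums and arithmetic in ℚ

toℚ-as-mkℚ : ∀ n → toℚ n ≡ mkℚ (ℤ.+ n) 0 (coprime-sym (1-coprimeTo n))
toℚ-as-mkℚ n = ↥p/↧p≡p (mkℚ (ℤ.+ n) 0 (coprime-sym (1-coprimeTo n)))

toℚ-+ : ∀ m n → toℚ (m ℕ.+ n) ≡ toℚ m + toℚ n
toℚ-+ m n = begin
  toℚ (m ℕ.+ n)                               ≡⟨ cong (_/ 1) (sym numerator) ⟩
  (ℤ.+ m ℤ.* ℤ.+ 1 ℤ.+ ℤ.+ n ℤ.* ℤ.+ 1) / 1   ≡⟨ sym (cong₂ _+_ (toℚ-as-mkℚ m) (toℚ-as-mkℚ n)) ⟩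
  toℚ m + toℚ n                               ∎
  where
  open ≡-Reasoning
  numerator : ℤ.+ m ℤ.* ℤ.+ 1 ℤ.+ ℤ.+ n ℤ.* ℤ.+ 1 ≡ ℤ.+ (m ℕ.+ n)
  numerator = trans (cong₂ ℤ._+_ (ℤ.*-identityʳ (ℤ.+ m)) (ℤ.*-identityʳ (ℤ.+ n))) (sym (ℤ.pos-+ m n))

toℚ-* : ∀ m n → toℚ (m ℕ.* n) ≡ toℚ m * toℚ n
toℚ-* m n = begin
  toℚ (m ℕ.* n)           ≡⟨ cong (_/ 1) (ℤ.pos-* m n) ⟩
  (ℤ.+ m ℤ.* ℤ.+ n) / 1   ≡⟨ sym (cong₂ _*_ (toℚ-as-mkℚ m) (toℚ-as-mkℚ n)) ⟩
  toℚ m * toℚ n           ∎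
  where open ≡-Reasoning

-- Callers pass m and n explicitly: the unifier cannot invert toℚ, and trying to makes it unfold
-- the normalisation of both sides.
toℚ-mono-≤ : ∀ {m n} → m ℕ.≤ n → toℚ m ≤ toℚ n
toℚ-mono-≤ {m} {n} m≤n rewrite toℚ-as-mkℚ m | toℚ-as-mkℚ n =
  *≤* (subst₂ ℤ._≤_ (sym (ℤ.*-identityʳ (ℤ.+ m))) (sym (ℤ.*-identityʳ (ℤ.+ n))) (+≤+ m≤n))

toℚ-cancel-≤ : ∀ {m n} → toℚ m ≤ toℚ n → m ℕ.≤ n
toℚ-cancel-≤ {m} {n} le rewrite toℚ-as-mkℚ m | toℚ-as-mkℚ n with le
... | *≤* mn with subst₂ ℤ._≤_ (ℤ.*-identityʳ (ℤ.+ m)) (ℤ.*-identityʳ (ℤ.+ n)) mn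
...   | +≤+ m≤n = m≤n

0≤toℚ : ∀ n → 0ℚ ≤ toℚ n
0≤toℚ n = toℚ-mono-≤ {0} {n} z≤n

toℚ-sum : ∀ {m} (f : Fin m → ℕ) → toℚ (ℕ∑.sum f) ≡ sum (toℚ ∘ f)
toℚ-sum {zero}  f = refl
toℚ-sum {suc m} f = trans (toℚ-+ (f zero) _) (cong (toℚ (f zero) +_) (toℚ-sum (f ∘ suc)))

sumℚ≡sum : ∀ m (f : Fin m → ℚ) → sumℚ m f ≡ sum f
sumℚ≡sum zero    f = refl
sumℚ≡sum (suc m) f = cong (f zero +_) (sumℚ≡sum m (f ∘ suc))

sumℕ≡sum : ∀ m (f : Fin m → ℕ) → sumℕ m f ≡ ℕ∑.sum f
sumℕ≡sum zero    f = refl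
sumℕ≡sum (suc m) f = cong (f zero ℕ.+_) (sumℕ≡sum m (f ∘ suc))

sum-mono-≤ : ∀ {m} {f g : Fin m → ℚ} → (∀ i → f i ≤ g i) → sum f ≤ sum g
sum-mono-≤ {zero}  f≤g = ≤-refl
sum-mono-≤ {suc m} f≤g = +-mono-≤ (f≤g zero) (sum-mono-≤ (f≤g ∘ suc))

sum-ones : ∀ m → sum (λ (_ : Fin m) → 1ℚ) ≡ toℚ m
sum-ones zero    = refl
sum-ones (suc m) = trans (cong (1ℚ +_) (sum-ones m)) (sym (toℚ-+ 1 m))

ℕ∑-mono-≤ : ∀ {m} {f g : Fin m → ℕ} → (∀ i → f i ℕ.≤ g i) → ℕ∑.sum f ℕ.≤ ℕ∑.sum g
ℕ∑-mono-≤ {zero}  f≤g = z≤n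
ℕ∑-mono-≤ {suc m} f≤g = ℕ.+-mono-≤ (f≤g zero) (ℕ∑-mono-≤ (f≤g ∘ suc))

ℕ∑-term≤ : ∀ {m} (f : Fin m → ℕ) i → f i ℕ.≤ ℕ∑.sum f
ℕ∑-term≤ f zero    = ℕ.m≤m+n (f zero) _
ℕ∑-term≤ f (suc i) = ℕ.≤-trans (ℕ∑-term≤ (f ∘ suc) i) (ℕ.m≤n+m _ (f zero))

ℕ∑-const : ∀ m c → ℕ∑.sum (λ (_ : Fin m) → c) ≡ m ℕ.* c
ℕ∑-const zero    c = refl
ℕ∑-const (suc m) c = cong (c ℕ.+_) (ℕ∑-const m c)

0≤* : ∀ {p q} → 0ℚ ≤ p → 0ℚ ≤ q → 0ℚ ≤ p * q
0≤* {p} {q} 0≤p 0≤q =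
  nonNegative⁻¹ (p * q) {{nonNeg*nonNeg⇒nonNeg p {{nonNegative 0≤p}} q {{nonNegative 0≤q}}}}

*-≢0 : ∀ {p q} → p ≢ 0ℚ → q ≢ 0ℚ → p * q ≢ 0ℚ
*-≢0 {p} {q} p≢0 q≢0 pq≡0 = q≢0 (begin
  q                ≡⟨ sym (*-identityˡ q) ⟩
  1ℚ * q           ≡⟨ cong (_* q) (sym (*-inverseˡ p)) ⟩
  1/ p * p * q     ≡⟨ *-assoc (1/ p) p q ⟩
  1/ p * (p * q)   ≡⟨ cong (1/ p *_) pq≡0 ⟩
  1/ p * 0ℚ        ≡⟨ *-zeroʳ (1/ p) ⟩
  0ℚ               ∎)
  where
  open ≡-Reasoning
  instance _ = ≢-nonZero p≢0

≤⇒0≤- : ∀ {p q} → p ≤ q → 0ℚ ≤ q - p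
≤⇒0≤- {p} p≤q = ≤-trans (≤-reflexive (sym (+-inverseʳ p))) (+-monoˡ-≤ (- p) p≤q)

÷-*-cancel : ∀ p q .{{_ : NonZero q}} → p ÷ q * q ≡ p
÷-*-cancel p q = trans (*-assoc p (1/ q) q) (trans (cong (p *_) (*-inverseˡ q)) (*-identityʳ p))

≤÷⇒*≤ : ∀ {t p q} (q>0 : 0ℚ < q) → t ≤ (p ÷ q) {{>-nonZero q>0}} → t * q ≤ p
≤÷⇒*≤ {p = p} {q} q>0 t≤p/q =
  ≤-trans (*-monoʳ-≤-nonNeg q {{nonNegative (<⇒≤ q>0)}} t≤p/q)
          (≤-reflexive (÷-*-cancel p q {{>-nonZero q>0}}))

0≤÷ : ∀ {p q} (q>0 : 0ℚ < q) → 0ℚ ≤ p → 0ℚ ≤ (p ÷ q) {{>-nonZero q>0}}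
0≤÷ {p} {q} q>0 0≤p = *-cancelʳ-≤-pos q {{positive q>0}} (begin
  0ℚ * q            ≡⟨ *-zeroˡ q ⟩
  0ℚ                ≤⟨ 0≤p ⟩
  p                 ≡⟨ sym (÷-*-cancel p q) ⟩
  p ÷ q * q         ∎)
  where
  open ≤-Reasoning
  instance _ = >-nonZero q>0

φ+[1-φ]≡1 : ∀ φ → φ + (1ℚ - φ) ≡ 1ℚ
φ+[1-φ]≡1 = solve 1 (λ φ → φ :+ (con 1ℚ :- φ) := con 1ℚ) refl

-- Linear dependence

lincomb : ∀ {m k} → (Fin m → ℚ) → (Fin m → Fin k → ℚ) → Fin k → ℚ
lincomb x a v = sum (λ i → x i * a i v)

lincomb-+ : ∀ {m k} (x y : Fin m → ℚ) (a : Fin m → Fin k → ℚ) v →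
            lincomb (λ i → x i + y i) a v ≡ lincomb x a v + lincomb y a v
lincomb-+ x y a v = trans (sum-cong-≗ (λ i → *-distribʳ-+ (a i v) (x i) (y i)))
                          (∑-distrib-+ (λ i → x i * a i v) (λ i → y i * a i v))

lincomb-scale : ∀ {m k} c (x : Fin m → ℚ) (a : Fin m → Fin k → ℚ) v →
                lincomb (λ i → c * x i) a v ≡ c * lincomb x a v
lincomb-scale c x a v = sym (trans (*-distribˡ-sum c (λ i → x i * a i v))
                                   (sum-cong-≗ (λ i → sym (*-assoc c (x i) (a i v)))))

lincomb-remove : ∀ {n k} (x : Fin (suc n) → ℚ) (a : Fin (suc n) → Fin k → ℚ) j v →
                 lincomb x a v ≡ x j * a j v + lincomb (removeAt x j) (removeAt a j) v
lincomb-remove x a j v = sum-remove {i = j} (λ i → x i * a i v)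

record LinearDependency {m k} (a : Fin m → Fin k → ℚ) : Set where
  field
    coeff    : Fin m → ℚ
    support  : Fin m
    coeff≢0  : coeff support ≢ 0ℚ
    vanishes : ∀ v → lincomb coeff a v ≡ 0ℚ
open LinearDependency

dropZeroColumn : ∀ {m k} (a : Fin m → Fin (suc k) → ℚ) → (∀ i → a i zero ≡ 0ℚ) →
                 LinearDependency (λ i v → a i (suc v)) → LinearDependency a
dropZeroColumn {m} a column≡0 l = record
  { coeff = coeff l ; support = support l ; coeff≢0 = coeff≢0 l ; vanishes = vanishes′ }
  where
  vanishes′ : ∀ v → lincomb (coeff l) a v ≡ 0ℚ
  vanishes′ zero    = trans (sum-cong-≗ (λ i → trans (cong (coeff l i *_) (column≡0 i))
                                                       (*-zeroʳ (coeff l i))))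
                            (sum-replicate-zero m)
  vanishes′ (suc v) = vanishes l v

-- One step of Gaussian elimination with pivot a p zero, applied to the rows other than p.
eliminate : ∀ {n k} → (Fin (suc n) → Fin (suc k) → ℚ) → Fin (suc n) → Fin n → Fin (suc k) → ℚ
eliminate a p i v = a p zero * a (punchIn p i) v - a (punchIn p i) zero * a p v

eliminate-zeroColumn : ∀ {n k} (a : Fin (suc n) → Fin (suc k) → ℚ) p i → eliminate a p i zero ≡ 0ℚ
eliminate-zeroColumn a p i =
  solve 2 (λ c d → c :* d :- d :* c := con 0ℚ) refl (a p zero) (a (punchIn p i) zero)

liftElimination : ∀ {n k} (a : Fin (suc n) → Fin (suc k) → ℚ) p → a p zero ≢ 0ℚ →
                  LinearDependency (eliminate a p) → LinearDependency a
liftElimination a p pivot≢0 μ = record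
  { coeff = l ; support = punchIn p (support μ) ; coeff≢0 = l≢0 ; vanishes = vanishes′ }
  where
  c = a p zero
  r = removeAt a p
  cμ = λ i → c * coeff μ i
  X = lincomb (coeff μ) r zero
  l = insertAt cμ p (- X)

  l≢0 : l (punchIn p (support μ)) ≢ 0ℚ
  l≢0 rewrite insertAt-punchIn cμ p (- X) (support μ) = *-≢0 pivot≢0 (coeff≢0 μ)

  eliminated : ∀ v → lincomb (coeff μ) (eliminate a p) v ≡ lincomb cμ r v + X * (- a p v)
  eliminated v = begin
    lincomb (coeff μ) (eliminate a p) v
      ≡⟨ sum-cong-≗ (λ i → solve 5 (λ m c x y z → m :* (c :* x :- y :* z) := c :* m :* x :+ m :* y :* (:- z))
                                   refl (coeff μ i) c (r i v) (r i zero) (a p v)) ⟩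
    sum (λ i → cμ i * r i v + coeff μ i * r i zero * (- a p v))
      ≡⟨ ∑-distrib-+ (λ i → cμ i * r i v) (λ i → coeff μ i * r i zero * (- a p v)) ⟩
    lincomb cμ r v + sum (λ i → coeff μ i * r i zero * (- a p v))
      ≡⟨ cong (lincomb cμ r v +_) (sym (*-distribʳ-sum (- a p v) (λ i → coeff μ i * r i zero))) ⟩
    lincomb cμ r v + X * (- a p v) ∎
    where open ≡-Reasoning

  vanishes′ : ∀ v → lincomb l a v ≡ 0ℚ
  vanishes′ v = begin
    lincomb l a v
      ≡⟨ lincomb-remove l a p v ⟩
    l p * a p v + lincomb (removeAt l p) r v
      ≡⟨ cong₂ (λ s t → s * a p v + t) (insertAt-lookup cμ p (- X))
               (sum-cong-≗ (λ i → cong (_* r i v) (insertAt-punchIn cμ p (- X) i))) ⟩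
    - X * a p v + lincomb cμ r v
      ≡⟨ solve 3 (λ x y z → :- x :* y :+ z := z :+ x :* (:- y)) refl X (a p v) (lincomb cμ r v) ⟩
    lincomb cμ r v + X * (- a p v)
      ≡⟨ sym (eliminated v) ⟩
    lincomb (coeff μ) (eliminate a p) v
      ≡⟨ vanishes μ v ⟩
    0ℚ ∎
    where open ≡-Reasoning

linearDependence : ∀ {k n} → k ℕ.≤ n → (a : Fin (suc n) → Fin k → ℚ) → LinearDependency a
linearDependence {zero} _ a = record { coeff = λ _ → 1ℚ ; support = zero ; coeff≢0 = 1≢0 ; vanishes = λ () }
linearDependence {suc k} k<n a with any? (λ i → ¬? (a i zero ≟ 0ℚ))
... | no noPivot = dropZeroColumn a (λ i → decidable-stable (a i zero ≟ 0ℚ) (λ a≢0 → noPivot (i , a≢0)))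
                     (linearDependence (ℕ.<⇒≤ k<n) (λ i v → a i (suc v)))
linearDependence {suc k} {suc n} (s≤s k≤n) a | yes (p , pivot≢0) =
  liftElimination a p pivot≢0
    (dropZeroColumn (eliminate a p) (eliminate-zeroColumn a p)
      (linearDependence k≤n (λ i v → eliminate a p i (suc v))))

scaleDependency : ∀ {m k} {a : Fin m → Fin k → ℚ} c → c ≢ 0ℚ → LinearDependency a → LinearDependency a
scaleDependency {a = a} c c≢0 l = record
  { coeff    = λ i → c * coeff l i
  ; support  = support l
  ; coeff≢0  = *-≢0 c≢0 (coeff≢0 l)
  ; vanishes = λ v → trans (lincomb-scale c (coeff l) a v) (trans (cong (c *_) (vanishes l v)) (*-zeroʳ c))
  }

orientDependency : ∀ {m k} {a : Fin m → Fin k → ℚ} → LinearDependency a →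
                   Σ (LinearDependency a) (λ d → 0ℚ ≤ sum (coeff d))
orientDependency l with ≤-total 0ℚ (sum (coeff l))
... | inj₁ 0≤sum = l , 0≤sum
... | inj₂ sum≤0 = scaleDependency (- 1ℚ) (λ ()) l , (begin
  0ℚ                            ≤⟨ neg-antimono-≤ sum≤0 ⟩
  - sum (coeff l)               ≡⟨ solve 1 (λ s → :- s := :- con 1ℚ :* s) refl (sum (coeff l)) ⟩
  - 1ℚ * sum (coeff l)          ≡⟨ *-distribˡ-sum (- 1ℚ) (coeff l) ⟩
  sum (λ i → - 1ℚ * coeff l i)  ∎)
  where open ≤-Reasoning

-- Rounding

module _ {c ℓ₁ ℓ₂} (O : TotalPreorder c ℓ₁ ℓ₂) where
  open TotalPreorder O using (Carrier; _≲_; total) renaming (refl to ≲-refl; trans to ≲-trans)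

  argmin : ∀ {m p} {P : Fin m → Set p} → Decidable P → (f : Fin m → Carrier) → ∃ P →
           ∃ λ j → P j × (∀ i → P i → f j ≲ f i)
  argmin {suc m} {P = P} P? f ∃P with any? (P? ∘ suc)
  ... | no ¬Psuc = zero , P0 ∃P , λ { zero _ → ≲-refl ; (suc i) Pi → ⊥-elim (¬Psuc (i , Pi)) }
    where
    P0 : ∃ P → P zero
    P0 (zero  , Pj) = Pj
    P0 (suc i , Pi) = ⊥-elim (¬Psuc (i , Pi))
  ... | yes Psuc with argmin (P? ∘ suc) (f ∘ suc) Psuc | P? zero
  ...   | j , Pj , min | no ¬P0 = suc j , Pj , λ { zero P0 → ⊥-elim (¬P0 P0) ; (suc i) Pi → min i Pi }
  ...   | j , Pj , min | yes P0 with total (f zero) (f (suc j))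
  ...     | inj₁ f0≲ = zero , P0 , λ { zero _ → ≲-refl ; (suc i) Pi → ≲-trans f0≲ (min i Pi) }
  ...     | inj₂ ≲f0 = suc j , Pj , λ { zero _ → ≲f0 ; (suc i) Pi → min i Pi }

InUnitInterval : ℚ → Set
InUnitInterval x = 0ℚ ≤ x × x ≤ 1ℚ

IsZeroOrOne : ℚ → Set
IsZeroOrOne x = x ≡ 0ℚ ⊎ x ≡ 1ℚ

unitInterval-minus : ∀ {φ s} → InUnitInterval φ → 0ℚ ≤ s → s ≤ φ → InUnitInterval (φ - s)
unitInterval-minus {φ} {s} (_ , φ≤1) 0≤s s≤φ = ≤⇒0≤- s≤φ , (begin
  φ - s    ≤⟨ +-monoʳ-≤ φ (neg-antimono-≤ 0≤s) ⟩
  φ + 0ℚ   ≡⟨ +-identityʳ φ ⟩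
  φ        ≤⟨ φ≤1 ⟩
  1ℚ       ∎)
  where open ≤-Reasoning

unitInterval-plus : ∀ {φ s} → InUnitInterval φ → 0ℚ ≤ s → s ≤ 1ℚ - φ → InUnitInterval (φ + s)
unitInterval-plus {φ} {s} (0≤φ , _) 0≤s s≤1-φ = (begin
  0ℚ             ≤⟨ 0≤φ ⟩
  φ              ≡⟨ sym (+-identityʳ φ) ⟩
  φ + 0ℚ         ≤⟨ +-monoʳ-≤ φ 0≤s ⟩
  φ + s          ∎) , (begin
  φ + s          ≤⟨ +-monoʳ-≤ φ s≤1-φ ⟩
  φ + (1ℚ - φ)   ≡⟨ φ+[1-φ]≡1 φ ⟩
  1ℚ             ∎)
  where open ≤-Reasoning

-- The largest t with φ + t * d ∈ [0,1], for φ ∈ [0,1] and d ≢ 0; the value 0 for d ≡ 0 is junk.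
timeToBoundary : ℚ → ℚ → ℚ
timeToBoundary φ d with <-cmp d 0ℚ
... | tri< d<0 _ _ = (φ ÷ (- d)) {{>-nonZero (neg-antimono-< d<0)}}
... | tri≈ _ _ _   = 0ℚ
... | tri> _ _ d>0 = ((1ℚ - φ) ÷ d) {{>-nonZero d>0}}

timeToBoundary-nonneg : ∀ {φ} d → InUnitInterval φ → 0ℚ ≤ timeToBoundary φ d
timeToBoundary-nonneg d (0≤φ , φ≤1) with <-cmp d 0ℚ
... | tri< d<0 _ _ = 0≤÷ (neg-antimono-< d<0) 0≤φ
... | tri≈ _ _ _   = ≤-refl
... | tri> _ _ d>0 = 0≤÷ d>0 (≤⇒0≤- φ≤1)

timeToBoundary-stays : ∀ {φ t} d → InUnitInterval φ → 0ℚ ≤ t → (d ≢ 0ℚ → t ≤ timeToBoundary φ d) →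
                       InUnitInterval (φ + t * d)
timeToBoundary-stays {φ} {t} d φ∈I 0≤t t≤T with <-cmp d 0ℚ
... | tri< d<0 d≢0 _ = subst InUnitInterval (solve 3 (λ φ t d → φ :- t :* (:- d) := φ :+ t :* d) refl φ t d)
                         (unitInterval-minus φ∈I (0≤* 0≤t (<⇒≤ -d>0)) (≤÷⇒*≤ -d>0 (t≤T d≢0)))
  where -d>0 = neg-antimono-< d<0
... | tri≈ _ refl _   = subst InUnitInterval (sym (trans (cong (φ +_) (*-zeroʳ t)) (+-identityʳ φ))) φ∈I
... | tri> _ d≢0 d>0 = unitInterval-plus φ∈I (0≤* 0≤t (<⇒≤ d>0)) (≤÷⇒*≤ d>0 (t≤T d≢0))

timeToBoundary-reaches : ∀ φ {d} → d ≢ 0ℚ → IsZeroOrOne (φ + timeToBoundary φ d * d)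
timeToBoundary-reaches φ {d} d≢0 with <-cmp d 0ℚ
... | tri< d<0 _ _ = inj₁ (begin
  φ + φ ÷ (- d) * d          ≡⟨ solve 3 (λ φ s d → φ :+ s :* d := φ :- s :* (:- d)) refl φ (φ ÷ (- d)) d ⟩
  φ - φ ÷ (- d) * (- d)      ≡⟨ cong (λ s → φ - s) (÷-*-cancel φ (- d)) ⟩
  φ - φ                      ≡⟨ +-inverseʳ φ ⟩
  0ℚ                         ∎)
  where
  open ≡-Reasoning
  instance _ = >-nonZero (neg-antimono-< d<0)
... | tri≈ _ d≡0 _ = ⊥-elim (d≢0 d≡0)
... | tri> _ _ d>0 = inj₂ (trans (cong (φ +_) (÷-*-cancel (1ℚ - φ) d)) (φ+[1-φ]≡1 φ))
  where instance _ = >-nonZero d>0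

record BoundaryPoint {m k} (a : Fin m → Fin k → ℚ) (φ : Fin m → ℚ) : Set where
  field
    point            : Fin m → ℚ
    point∈cube       : ∀ i → InUnitInterval (point i)
    tight            : Fin m
    tight-01         : IsZeroOrOne (point tight)
    same-combination : ∀ v → lincomb point a v ≡ lincomb φ a v
    sum-≤            : sum φ ≤ sum point
open BoundaryPoint

-- Move φ along a dependency d with Σ d ≥ 0 until the first coordinate reaches 0 or 1.
toBoundary : ∀ {k n} → k ℕ.≤ n → (a : Fin (suc n) → Fin k → ℚ) (φ : Fin (suc n) → ℚ) →
             (∀ i → InUnitInterval (φ i)) → BoundaryPoint a φ
toBoundary k≤n a φ φ∈cube = record
  { point            = φ′
  ; point∈cube       = λ i → timeToBoundary-stays (d i) (φ∈cube i) 0≤t (first i)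
  ; tight            = j
  ; tight-01         = timeToBoundary-reaches (φ j) dj≢0
  ; same-combination = same-combination′
  ; sum-≤            = sum-≤′
  }
  where
  open ≤-Reasoning
  oriented = orientDependency (linearDependence k≤n a)
  dep = proj₁ oriented
  d = coeff dep
  exit = argmin ≤-totalPreorder (λ i → ¬? (d i ≟ 0ℚ)) (λ i → timeToBoundary (φ i) (d i))
                (support dep , coeff≢0 dep)
  j = proj₁ exit
  dj≢0 = proj₁ (proj₂ exit)
  first = proj₂ (proj₂ exit)
  t = timeToBoundary (φ j) (d j)
  0≤t = timeToBoundary-nonneg (d j) (φ∈cube j)
  φ′ : Fin _ → ℚ
  φ′ i = φ i + t * d i

  same-combination′ : ∀ v → lincomb φ′ a v ≡ lincomb φ a v
  same-combination′ v = begin-equality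
    lincomb φ′ a v                                ≡⟨ lincomb-+ φ (λ i → t * d i) a v ⟩
    lincomb φ a v + lincomb (λ i → t * d i) a v   ≡⟨ cong (lincomb φ a v +_) (lincomb-scale t d a v) ⟩
    lincomb φ a v + t * lincomb d a v             ≡⟨ cong (λ s → lincomb φ a v + t * s) (vanishes dep v) ⟩
    lincomb φ a v + t * 0ℚ                        ≡⟨ cong (lincomb φ a v +_) (*-zeroʳ t) ⟩
    lincomb φ a v + 0ℚ                            ≡⟨ +-identityʳ (lincomb φ a v) ⟩
    lincomb φ a v                                 ∎

  sum-≤′ : sum φ ≤ sum φ′
  sum-≤′ = begin
    sum φ                         ≡⟨ sym (+-identityʳ (sum φ)) ⟩
    sum φ + 0ℚ                    ≤⟨ +-monoʳ-≤ (sum φ) (0≤* 0≤t (proj₂ oriented)) ⟩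
    sum φ + t * sum d             ≡⟨ cong (sum φ +_) (*-distribˡ-sum t d) ⟩
    sum φ + sum (λ i → t * d i)   ≡⟨ sym (∑-distrib-+ φ (λ i → t * d i)) ⟩
    sum φ′                        ∎

record IntegerRounding {m k} (a : Fin m → Fin k → ℚ) (x : Fin m → ℚ) : Set where
  field
    rounded   : Fin m → ℕ
    lincomb-≤ : ∀ v → lincomb (toℚ ∘ rounded) a v ≤ lincomb x a v
    sum-≥     : sum x - toℚ k ≤ sum (toℚ ∘ rounded)
open IntegerRounding

rounding-transfer : ∀ {m k} {a : Fin m → Fin k → ℚ} {x x′} →
                    (∀ v → lincomb x a v ≤ lincomb x′ a v) → sum x′ ≤ sum x →
                    IntegerRounding a x → IntegerRounding a x′
rounding-transfer {k = k} lincomb≤ sum≤ y = record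
  { rounded   = rounded y
  ; lincomb-≤ = λ v → ≤-trans (lincomb-≤ y v) (lincomb≤ v)
  ; sum-≥     = ≤-trans (+-monoˡ-≤ (- toℚ k) sum≤) (sum-≥ y)
  }

rounding-insert : ∀ {n k} {a : Fin (suc n) → Fin k → ℚ} {x} j b → toℚ b ≡ x j →
                  IntegerRounding (removeAt a j) (removeAt x j) → IntegerRounding a x
rounding-insert {k = k} {a} {x} j b b≡xj z = record
  { rounded = y ; lincomb-≤ = lincomb-≤′ ; sum-≥ = sum-≥′ }
  where
  open ≤-Reasoning
  y = insertAt (rounded z) j b
  y-fixed : toℚ (y j) ≡ x j
  y-fixed = trans (cong toℚ (insertAt-lookup (rounded z) j b)) b≡xj
  y-rest : ∀ i → toℚ (y (punchIn j i)) ≡ toℚ (rounded z i)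
  y-rest i = cong toℚ (insertAt-punchIn (rounded z) j b i)

  lincomb-≤′ : ∀ v → lincomb (toℚ ∘ y) a v ≤ lincomb x a v
  lincomb-≤′ v = begin
    lincomb (toℚ ∘ y) a v
      ≡⟨ lincomb-remove (toℚ ∘ y) a j v ⟩
    toℚ (y j) * a j v + lincomb (removeAt (toℚ ∘ y) j) (removeAt a j) v
      ≡⟨ cong₂ (λ s t → s * a j v + t) y-fixed (sum-cong-≗ (λ i → cong (_* a (punchIn j i) v) (y-rest i))) ⟩
    x j * a j v + lincomb (toℚ ∘ rounded z) (removeAt a j) v
      ≤⟨ +-monoʳ-≤ (x j * a j v) (lincomb-≤ z v) ⟩
    x j * a j v + lincomb (removeAt x j) (removeAt a j) v
      ≡⟨ sym (lincomb-remove x a j v) ⟩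
    lincomb x a v ∎

  sum-≥′ : sum x - toℚ k ≤ sum (toℚ ∘ y)
  sum-≥′ = begin
    sum x - toℚ k                          ≡⟨ cong (_- toℚ k) (sum-remove {i = j} x) ⟩
    x j + sum (removeAt x j) - toℚ k       ≡⟨ +-assoc (x j) (sum (removeAt x j)) (- toℚ k) ⟩
    x j + (sum (removeAt x j) - toℚ k)     ≤⟨ +-monoʳ-≤ (x j) (sum-≥ z) ⟩
    x j + sum (toℚ ∘ rounded z)            ≡⟨ cong₂ _+_ (sym y-fixed) (sum-cong-≗ (λ i → sym (y-rest i))) ⟩
    toℚ (y j) + sum (removeAt (toℚ ∘ y) j) ≡⟨ sym (sum-remove {i = j} (toℚ ∘ y)) ⟩
    sum (toℚ ∘ y)                          ∎

rounding-shift : ∀ {m k} {a : Fin m → Fin k → ℚ} {φ} (L : Fin m → ℕ) →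
                 IntegerRounding a φ → IntegerRounding a (λ i → toℚ (L i) + φ i)
rounding-shift {k = k} {a} {φ} L z = record
  { rounded = L+z ; lincomb-≤ = lincomb-≤′ ; sum-≥ = sum-≥′ }
  where
  open ≤-Reasoning
  Lℚ = toℚ ∘ L
  zℚ = toℚ ∘ rounded z
  L+z : Fin _ → ℕ
  L+z i = L i ℕ.+ rounded z i
  toℚ-L+z : ∀ i → toℚ (L+z i) ≡ Lℚ i + zℚ i
  toℚ-L+z i = toℚ-+ (L i) (rounded z i)

  lincomb-≤′ : ∀ v → lincomb (toℚ ∘ L+z) a v ≤ lincomb (λ i → Lℚ i + φ i) a v
  lincomb-≤′ v = begin
    lincomb (toℚ ∘ L+z) a v            ≡⟨ sum-cong-≗ (λ i → cong (_* a i v) (toℚ-L+z i)) ⟩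
    lincomb (λ i → Lℚ i + zℚ i) a v    ≡⟨ lincomb-+ Lℚ zℚ a v ⟩
    lincomb Lℚ a v + lincomb zℚ a v    ≤⟨ +-monoʳ-≤ (lincomb Lℚ a v) (lincomb-≤ z v) ⟩
    lincomb Lℚ a v + lincomb φ a v     ≡⟨ sym (lincomb-+ Lℚ φ a v) ⟩
    lincomb (λ i → Lℚ i + φ i) a v     ∎

  sum-≥′ : sum (λ i → Lℚ i + φ i) - toℚ k ≤ sum (toℚ ∘ L+z)
  sum-≥′ = begin
    sum (λ i → Lℚ i + φ i) - toℚ k     ≡⟨ cong (_- toℚ k) (∑-distrib-+ Lℚ φ) ⟩
    sum Lℚ + sum φ - toℚ k             ≡⟨ +-assoc (sum Lℚ) (sum φ) (- toℚ k) ⟩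
    sum Lℚ + (sum φ - toℚ k)           ≤⟨ +-monoʳ-≤ (sum Lℚ) (sum-≥ z) ⟩
    sum Lℚ + sum zℚ                    ≡⟨ sym (∑-distrib-+ Lℚ zℚ) ⟩
    sum (λ i → Lℚ i + zℚ i)            ≡⟨ sum-cong-≗ (λ i → sym (toℚ-L+z i)) ⟩
    sum (toℚ ∘ L+z)                    ∎

roundToZero : ∀ {k m} (a : Fin m → Fin k → ℚ) → (∀ i v → 0ℚ ≤ a i v) → m ℕ.≤ k →
              (φ : Fin m → ℚ) → (∀ i → InUnitInterval (φ i)) → IntegerRounding a φ
roundToZero {k} {m} a a≥0 m≤k φ φ∈cube = record
  { rounded   = λ _ → 0
  ; lincomb-≤ = λ v → sum-mono-≤ (λ i → *-monoʳ-≤-nonNeg (a i v) {{nonNegative (a≥0 i v)}} (proj₁ (φ∈cube i)))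
  ; sum-≥     = begin
      sum φ - toℚ k                      ≤⟨ +-monoˡ-≤ (- toℚ k) (sum-mono-≤ (proj₂ ∘ φ∈cube)) ⟩
      sum (λ (_ : Fin m) → 1ℚ) - toℚ k   ≡⟨ cong (_- toℚ k) (sum-ones m) ⟩
      toℚ m - toℚ k                      ≤⟨ +-monoˡ-≤ (- toℚ k) (toℚ-mono-≤ {m} {k} m≤k) ⟩
      toℚ k - toℚ k                      ≡⟨ +-inverseʳ (toℚ k) ⟩
      0ℚ                                 ≡⟨ sym (sum-replicate-zero m) ⟩
      sum (λ (_ : Fin m) → 0ℚ)           ∎
  }
  where open ≤-Reasoning

zeroOrOne-toℚ : ∀ {x} → IsZeroOrOne x → ∃ λ b → toℚ b ≡ x
zeroOrOne-toℚ (inj₁ refl) = 0 , refl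
zeroOrOne-toℚ (inj₂ refl) = 1 , refl

roundUnitInterval : ∀ {k m} (a : Fin m → Fin k → ℚ) → (∀ i v → 0ℚ ≤ a i v) →
                    (φ : Fin m → ℚ) → (∀ i → InUnitInterval (φ i)) → IntegerRounding a φ
roundUnitInterval {k} {m} a a≥0 φ φ∈cube with k ℕ.<? m
... | no k≮m = roundToZero a a≥0 (ℕ.≮⇒≥ k≮m) φ φ∈cube
... | yes (s≤s k≤n) =
  rounding-transfer (λ v → ≤-reflexive (same-combination q v)) (sum-≤ q)
    (rounding-insert {x = point q} j (proj₁ bit) (proj₂ bit)
      (roundUnitInterval (removeAt a j) (a≥0 ∘ punchIn j) (removeAt (point q) j) (point∈cube q ∘ punchIn j)))
  where
  q = toBoundary k≤n a φ φ∈cube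
  j = tight q
  bit = zeroOrOne-toℚ (tight-01 q)

boundedMaximum : ∀ {p} {P : ℕ → Set p} → Decidable P → P 0 → ∀ B → (∀ {n} → P n → n ℕ.≤ B) →
                 ∃ λ M → P M × (∀ {n} → P n → n ℕ.≤ M)
boundedMaximum P? P0 zero    bounded = 0 , P0 , bounded
boundedMaximum P? P0 (suc B) bounded with P? (suc B)
... | yes PB = suc B , PB , bounded
... | no ¬PB = boundedMaximum P? P0 B (λ Pn → ℕ.s≤s⁻¹ (ℕ.≤∧≢⇒< (bounded Pn) (λ { refl → ¬PB Pn })))

archimedean : ∀ x → 0ℚ ≤ x → ∃ λ N → x ≤ toℚ N
archimedean x@(mkℚ (ℤ.+ n) d _) _ = n , subst (x ≤_) (sym (toℚ-as-mkℚ n)) (*≤* n*1≤n*[1+d])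
  where
  n*1≤n*[1+d] : ℤ.+ n ℤ.* ℤ.+ 1 ℤ.≤ ℤ.+ n ℤ.* ℤ.+ suc d
  n*1≤n*[1+d] = subst₂ ℤ._≤_ (ℤ.pos-* n 1) (ℤ.pos-* n (suc d)) (+≤+ (ℕ.*-monoʳ-≤ n (s≤s z≤n)))
archimedean (mkℚ ℤ.-[1+ _ ] _ _) (*≤* ())

floorℕ : ∀ x → 0ℚ ≤ x → ∃ λ n → toℚ n ≤ x × x ≤ toℚ (suc n)
floorℕ x 0≤x = M , M≤x , decidable-stable (x ≤? toℚ (suc M)) (λ x≰1+M → ℕ.1+n≰n (maximal (<⇒≤ (≰⇒> x≰1+M))))
  where
  bound = archimedean x 0≤x
  largest = boundedMaximum (λ n → toℚ n ≤? x) 0≤x (proj₁ bound)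
                           (λ {n} n≤x → toℚ-cancel-≤ {n} (≤-trans n≤x (proj₂ bound)))
  M = proj₁ largest
  M≤x = proj₁ (proj₂ largest)
  maximal = proj₂ (proj₂ largest)

roundNonneg : ∀ {k m} (a : Fin m → Fin k → ℚ) → (∀ i v → 0ℚ ≤ a i v) →
              (x : Fin m → ℚ) → (∀ i → 0ℚ ≤ x i) → IntegerRounding a x
roundNonneg a a≥0 x x≥0 =
  rounding-transfer (λ v → ≤-reflexive (sum-cong-≗ (λ i → cong (_* a i v) (split i))))
                    (≤-reflexive (sum-cong-≗ (λ i → sym (split i))))
    (rounding-shift L (roundUnitInterval a a≥0 φ φ∈cube))
  where
  L : Fin _ → ℕ
  L i = proj₁ (floorℕ (x i) (x≥0 i))
  φ : Fin _ → ℚ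
  φ i = x i - toℚ (L i)
  split : ∀ i → toℚ (L i) + φ i ≡ x i
  split i = solve 2 (λ l x → l :+ (x :- l) := x) refl (toℚ (L i)) (x i)
  φ∈cube : ∀ i → InUnitInterval (φ i)
  φ∈cube i = ≤⇒0≤- L≤x , (begin
    x i - toℚ (L i)              ≤⟨ +-monoˡ-≤ (- toℚ (L i)) x≤1+L ⟩
    toℚ (suc (L i)) - toℚ (L i)  ≡⟨ cong (_- toℚ (L i)) (toℚ-+ 1 (L i)) ⟩
    1ℚ + toℚ (L i) - toℚ (L i)   ≡⟨ solve 1 (λ l → con 1ℚ :+ l :- l := con 1ℚ) refl (toℚ (L i)) ⟩
    1ℚ                           ∎)
    where
    open ≤-Reasoning
    L≤x = proj₁ (proj₂ (floorℕ (x i) (x≥0 i)))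
    x≤1+L = proj₂ (proj₂ (floorℕ (x i) (x≥0 i)))

-- Intersecting families

Searchable : Set → Set₁
Searchable A = ∀ {P : A → Set} → Decidable P → Dec (∃ P)

Vec-searchable : ∀ {A} → Searchable A → ∀ n → Searchable (Vec A n)
Vec-searchable search zero    P? = map′ ([] ,_) (λ { ([] , P[]) → P[] }) (P? [])
Vec-searchable search (suc n) P? =
  map′ (λ (x , xs , Pxxs) → x ∷ xs , Pxxs) (λ { (x ∷ xs , Pxxs) → x , xs , Pxxs })
       (search (λ x → Vec-searchable search n (P? ∘ (x ∷_))))

incidence : ∀ {k m} → (Fin m → Subset k) → Fin m → Fin k → ℕ
incidence e i v = if does (v ∈? e i) then 1 else 0

incidence-∈ : ∀ {k m} (e : Fin m → Subset k) {i v} → v ∈ e i → incidence e i v ≡ 1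
incidence-∈ e {i} {v} v∈ei rewrite dec-true (v ∈? e i) v∈ei = refl

PairwiseMeeting : ∀ {k N} → (Fin N → Subset k) → Set
PairwiseMeeting e = ∀ a b → Meet (e a) (e b)

hypergraph : ∀ {k N} (e : Fin N → Subset k) → PairwiseMeeting e → Hypergraph k
hypergraph {N = N} e meet = record { m = N ; edge = e ; nonempty = λ a → selfMeet (meet a a) }
  where
  selfMeet : ∀ {s} → Nonempty (s ∩ s) → Nonempty s
  selfMeet {s} (x , x∈s∩s) = x , proj₁ (x∈p∩q⁻ s s x∈s∩s)

-- Unlike Intersecting, each edge must also meet itself; this is what makes the edges nonempty.
IntersectingFamily : ∀ {k N} → ℕ → (Fin N → Subset k) → Set
IntersectingFamily Δ e = Σ (PairwiseMeeting e) λ meet → MaxDegreeAtMost (hypergraph e meet) Δ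

HasIntersectingFamily : ℕ → ℕ → ℕ → Set
HasIntersectingFamily k Δ N = ∃ λ (es : Vec (Subset k) N) → IntersectingFamily Δ (lookup es)

intersectingFamily? : ∀ {k N} Δ (e : Fin N → Subset k) → Dec (IntersectingFamily Δ e)
intersectingFamily? Δ e with all? (λ a → all? (λ b → nonempty? (e a ∩ e b)))
... | no ¬meet = no (¬meet ∘ proj₁)
... | yes meet = map′ (meet ,_) proj₂ (all? (λ v → degree (hypergraph e meet) v ℕ.≤? Δ))

intersectingFamily-size : ∀ {k N} Δ (e : Fin N → Subset k) → IntersectingFamily Δ e → N ℕ.≤ k ℕ.* Δ
intersectingFamily-size {k} {N} Δ e (meet , degree≤Δ) = begin
  N                                              ≡⟨ sym (trans (ℕ∑-const N 1) (ℕ.*-identityʳ N)) ⟩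
  ℕ∑.sum (λ (_ : Fin N) → 1)                     ≤⟨ ℕ∑-mono-≤ edge-nonempty ⟩
  ℕ∑.sum (λ a → ℕ∑.sum (incidence e a))          ≡⟨ ℕ∑.∑-comm (incidence e) ⟩
  ℕ∑.sum (λ v → ℕ∑.sum (λ a → incidence e a v))  ≡⟨ ℕ∑.sum-cong-≗ (λ v → sym (sumℕ≡sum N (flip (incidence e) v))) ⟩
  ℕ∑.sum (degree (hypergraph e meet))            ≤⟨ ℕ∑-mono-≤ degree≤Δ ⟩
  ℕ∑.sum (λ (_ : Fin k) → Δ)                     ≡⟨ ℕ∑-const k Δ ⟩
  k ℕ.* Δ                                        ∎
  where
  open ℕ.≤-Reasoning
  edge-nonempty : ∀ a → 1 ℕ.≤ ℕ∑.sum (incidence e a)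
  edge-nonempty a with nonempty (hypergraph e meet) a
  ... | v , v∈ea = subst (ℕ._≤ ℕ∑.sum (incidence e a)) (incidence-∈ e v∈ea) (ℕ∑-term≤ (incidence e a) v)

record LargestIntersectingFamily (k Δ : ℕ) : Set where
  field
    edgeCount : ℕ
    edges     : Vec (Subset k) edgeCount
    family    : IntersectingFamily Δ (lookup edges)
    largest   : ∀ {N} → HasIntersectingFamily k Δ N → N ℕ.≤ edgeCount

largestIntersectingFamily : ∀ k Δ → LargestIntersectingFamily k Δ
largestIntersectingFamily k Δ = record
  { edgeCount = proj₁ maximum
  ; edges     = proj₁ (proj₁ (proj₂ maximum))
  ; family    = proj₂ (proj₁ (proj₂ maximum))
  ; largest   = proj₂ (proj₂ maximum)
  }
  where
  maximum = boundedMaximum (λ N → Vec-searchable anySubset? N (intersectingFamily? Δ ∘ lookup))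
                           ([] , (λ ()) , (λ _ → z≤n)) (k ℕ.* Δ)
                           (λ (es , family) → intersectingFamily-size Δ (lookup es) family)

intersecting⇒edges≤colours : ∀ {k} (H : Hypergraph k) → Intersecting H →
                             ∀ {c} (col : Fin (m H) → Fin c) → ProperEdgeColouring H c col → m H ℕ.≤ c
intersecting⇒edges≤colours H intersecting col proper =
  injective⇒≤ λ {i} {j} same →
    decidable-stable (i ≟ᶠ j) (λ i≢j → proper i j i≢j (intersecting i j i≢j) same)

intersecting⇒pairwiseMeeting : ∀ {k} (G : Hypergraph k) → Intersecting G → PairwiseMeeting (edge G)
intersecting⇒pairwiseMeeting G intersecting i j with i ≟ᶠ j
... | no i≢j = intersecting i j i≢j
... | yes refl with nonempty G i
...   | u , u∈ei = u , x∈p∩q⁺ (u∈ei , u∈ei)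

replicateEach : ∀ {A : Set} {m} (y : Fin m → ℕ) → (Fin m → A) → Vec A (ℕ∑.sum y)
replicateEach {m = zero}  y e = []
replicateEach {m = suc m} y e = replicate (y zero) (e zero) ++ replicateEach (y ∘ suc) (e ∘ suc)

lookup-replicateEach : ∀ {A : Set} {P : A → Set} {m} (y : Fin m → ℕ) (e : Fin m → A) →
                       (∀ i → P (e i)) → ∀ a → P (lookup (replicateEach y e) a)
lookup-replicateEach {P = P} y e Pe = lookup⁺ (all y e Pe)
  where
  all-replicate : ∀ n {x} → P x → All P (replicate n x)
  all-replicate zero    Px = []
  all-replicate (suc n) Px = Px ∷ all-replicate n Px
  all : ∀ {m} (y : Fin m → ℕ) (e : Fin m → _) → (∀ i → P (e i)) → All P (replicateEach y e)
  all {zero}  y e Pe = []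
  all {suc m} y e Pe = ++⁺ (all-replicate (y zero) (Pe zero)) (all (y ∘ suc) (e ∘ suc) (Pe ∘ suc))

sum-lookup-++ : ∀ {A : Set} {m n} (f : A → ℕ) (xs : Vec A m) (ys : Vec A n) →
                ℕ∑.sum (f ∘ lookup (xs ++ ys)) ≡ ℕ∑.sum (f ∘ lookup xs) ℕ.+ ℕ∑.sum (f ∘ lookup ys)
sum-lookup-++ f []       ys = refl
sum-lookup-++ f (x ∷ xs) ys = trans (cong (f x ℕ.+_) (sum-lookup-++ f xs ys)) (sym (ℕ.+-assoc (f x) _ _))

sum-lookup-replicate : ∀ {A : Set} (f : A → ℕ) n x → ℕ∑.sum (f ∘ lookup (replicate n x)) ≡ n ℕ.* f x
sum-lookup-replicate f zero    x = refl
sum-lookup-replicate f (suc n) x = cong (f x ℕ.+_) (sum-lookup-replicate f n x)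

sum-lookup-replicateEach : ∀ {A : Set} {m} (f : A → ℕ) (y : Fin m → ℕ) (e : Fin m → A) →
                           ℕ∑.sum (f ∘ lookup (replicateEach y e)) ≡ ℕ∑.sum (λ i → y i ℕ.* f (e i))
sum-lookup-replicateEach {m = zero}  f y e = refl
sum-lookup-replicateEach {m = suc m} f y e =
  trans (sum-lookup-++ f (replicate (y zero) (e zero)) (replicateEach (y ∘ suc) (e ∘ suc)))
        (cong₂ ℕ._+_ (sum-lookup-replicate f (y zero) (e zero))
                     (sum-lookup-replicateEach f (y ∘ suc) (e ∘ suc)))

replicateEach-pairwiseMeeting : ∀ {k m} (y : Fin m → ℕ) (e : Fin m → Subset k) →
                                PairwiseMeeting e → PairwiseMeeting (lookup (replicateEach y e))
replicateEach-pairwiseMeeting y e meet p =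
  lookup-replicateEach {P = Meet (lookup (replicateEach y e) p)} y e
    (lookup-replicateEach {P = λ s → ∀ j → Meet s (e j)} y e meet p)

-- From fractional matchings to intersecting families

incidenceℚ : ∀ {k m} → (Fin m → Subset k) → Fin m → Fin k → ℚ
incidenceℚ e i v = toℚ (incidence e i v)

degree-replicateEach : ∀ {k m} (y : Fin m → ℕ) (e : Fin m → Subset k) meet v →
  toℚ (degree (hypergraph (lookup (replicateEach y e)) meet) v) ≡ lincomb (toℚ ∘ y) (incidenceℚ e) v
degree-replicateEach y e meet v = begin
  toℚ (sumℕ (ℕ∑.sum y) (λ p → incidence (lookup es) p v))
    ≡⟨ cong toℚ (sumℕ≡sum (ℕ∑.sum y) (λ p → incidence (lookup es) p v)) ⟩
  toℚ (ℕ∑.sum (λ p → incidence (lookup es) p v))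
    ≡⟨ cong toℚ (sum-lookup-replicateEach (λ s → if does (v ∈? s) then 1 else 0) y e) ⟩
  toℚ (ℕ∑.sum (λ i → y i ℕ.* incidence e i v))
    ≡⟨ toℚ-sum (λ i → y i ℕ.* incidence e i v) ⟩
  sum (λ i → toℚ (y i ℕ.* incidence e i v))
    ≡⟨ sum-cong-≗ (λ i → toℚ-* (y i) (incidence e i v)) ⟩
  lincomb (toℚ ∘ y) (incidenceℚ e) v ∎
  where
  open ≡-Reasoning
  es = replicateEach y e

scaledMatching-load : ∀ {k} Δ (G : Hypergraph k) (f : FractionalMatching G) v →
                      lincomb (λ i → toℚ Δ * w f i) (incidenceℚ (edge G)) v ≤ toℚ Δ
scaledMatching-load Δ G f v = begin
  lincomb (λ i → toℚ Δ * w f i) (incidenceℚ (edge G)) v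
    ≡⟨ lincomb-scale (toℚ Δ) (w f) (incidenceℚ (edge G)) v ⟩
  toℚ Δ * lincomb (w f) (incidenceℚ (edge G)) v
    ≡⟨ cong (toℚ Δ *_) (trans (sum-cong-≗ (λ i → masked (w f i) (does (v ∈? edge G i))))
                              (sym (sumℚ≡sum (m G) load))) ⟩
  toℚ Δ * sumℚ (m G) load
    ≤⟨ *-monoˡ-≤-nonNeg (toℚ Δ) {{nonNegative (0≤toℚ Δ)}} (vertex≤1 f v) ⟩
  toℚ Δ * 1ℚ
    ≡⟨ *-identityʳ (toℚ Δ) ⟩
  toℚ Δ ∎
  where
  open ≤-Reasoning
  load : Fin (m G) → ℚ
  load i = if does (v ∈? edge G i) then w f i else 0ℚ
  masked : ∀ q b → q * toℚ (if b then 1 else 0) ≡ (if b then q else 0ℚ)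
  masked q Bool.true  = *-identityʳ q
  masked q Bool.false = *-zeroʳ q

-- The rounding is a parameter rather than computed here, so that the unifier never unfolds it.
roundedMatchingFamily : ∀ {k} Δ (G : Hypergraph k) → Intersecting G → (f : FractionalMatching G) →
  IntegerRounding (incidenceℚ (edge G)) (λ i → toℚ Δ * w f i) →
  ∃ λ N → HasIntersectingFamily k Δ N × size f * toℚ Δ - toℚ k ≤ toℚ N
roundedMatchingFamily {k} Δ G intersecting f r = ℕ∑.sum y , (es , meet , degree≤Δ) , large
  where
  open ≤-Reasoning
  y = rounded r
  es = replicateEach y (edge G)
  meet = replicateEach-pairwiseMeeting y (edge G) (intersecting⇒pairwiseMeeting G intersecting)

  degree≤Δ : MaxDegreeAtMost (hypergraph (lookup es) meet) Δ
  degree≤Δ v = toℚ-cancel-≤ {degree (hypergraph (lookup es) meet) v} {Δ} (begin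
    toℚ (degree (hypergraph (lookup es) meet) v)              ≡⟨ degree-replicateEach y (edge G) meet v ⟩
    lincomb (toℚ ∘ y) (incidenceℚ (edge G)) v                 ≤⟨ lincomb-≤ r v ⟩
    lincomb (λ i → toℚ Δ * w f i) (incidenceℚ (edge G)) v     ≤⟨ scaledMatching-load Δ G f v ⟩
    toℚ Δ                                                     ∎)

  large : size f * toℚ Δ - toℚ k ≤ toℚ (ℕ∑.sum y)
  large = begin
    size f * toℚ Δ - toℚ k             ≡⟨ cong (_- toℚ k) (*-comm (size f) (toℚ Δ)) ⟩
    toℚ Δ * size f - toℚ k             ≡⟨ cong (λ s → toℚ Δ * s - toℚ k) (sumℚ≡sum (m G) (w f)) ⟩
    toℚ Δ * sum (w f) - toℚ k          ≡⟨ cong (_- toℚ k) (*-distribˡ-sum (toℚ Δ) (w f)) ⟩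
    sum (λ i → toℚ Δ * w f i) - toℚ k  ≤⟨ sum-≥ r ⟩
    sum (toℚ ∘ y)                      ≡⟨ sym (toℚ-sum y) ⟩
    toℚ (ℕ∑.sum y)                     ∎

matchingFamily : ∀ {k} Δ (G : Hypergraph k) → Intersecting G → (f : FractionalMatching G) →
                 ∃ λ N → HasIntersectingFamily k Δ N × size f * toℚ Δ - toℚ k ≤ toℚ N
matchingFamily Δ G intersecting f = roundedMatchingFamily Δ G intersecting f
  (roundNonneg (incidenceℚ (edge G)) (λ i v → 0≤toℚ (incidence (edge G) i v))
               (λ i → toℚ Δ * w f i) (λ i → 0≤* (0≤toℚ Δ) (w≥0 f i)))

lemma2p7 : (k Δ : ℕ) → 1 ℕ.≤ k → 1 ℕ.≤ Δ →
    Σ (Hypergraph k) (λ H → MaxDegreeAtMost H Δ × ChromaticIndexAtLeastνΔ-k H Δ)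
lemma2p7 k Δ _ _ = H , proj₂ family , χ′≥
  where
  open LargestIntersectingFamily (largestIntersectingFamily k Δ)
  H = hypergraph (lookup edges) (proj₁ family)
  χ′≥ : ChromaticIndexAtLeastνΔ-k H Δ
  χ′≥ G intersecting f c col proper =
    let (N , hasFamily , N≥) = matchingFamily Δ G intersecting f
        edges≤colours = intersecting⇒edges≤colours H (λ a b _ → proj₁ family a b) col proper
    in ≤-trans N≥ (toℚ-mono-≤ {N} {c} (ℕ.≤-trans (largest hasFamily) edges≤colours))
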